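{- In the $2$-Labeled Coupon Collector Problem on $n\ge 3$ coupons, let $T(r)$ denote the number of samples needed until at least $r$ coupons have their labels determined. Then $T(1)=T(2)=T(3)$.
   Context: $2$-Labeled Coupon Collector Problem: there are $n$ coupons $C$ and $n$ labels $L$ with an unknown bijection $\sigma:C\to L$. Samples are independent; each sample is a uniformly random $2$-element subset $S\subseteq C$, and the collector observes only the pair of sets $(S,\sigma(S))$, not which label goes with which coupon. The collector has no prior knowledge of $C$ and $L$ beyond what appears in samples. After samples $(S_1,\sigma(S_1)),\dots,(S_t,\sigma(S_t))$, let $C_t=\bigcup_i S_i$, $L_t=\bigcup_i\sigma(S_i)$; a bijection $f:C_t\to L_t$ is consistent if $f(S_i)=\sigma(S_i)$ for all $i$, and a coupon $c$ has its label determined if $c\in C_t$ and all consistent $f$ agree at $c$. $T(r)$ is the least $t$ such that at least $r$ coupons have their labels determined. -}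

module Defs where

open import Data.Nat using (ℕ; _<_)
open import Data.Fin using (Fin)
open import Data.Product using (Σ; ∃; ∃-syntax; _×_; _,_)
open import Data.Sum using (_⊎_)
open import Relation.Binary.PropositionalEquality using (_≡_; _≢_)
open import Relation.Nullary using (¬_)
open import Function.Bundles using (_↔_; Inverse)
open import Function.Definitions using (Injective)

-- A sample: a 2-element subset {a , b} of the coupons Fin n (a ≢ b).
record Sample (n : ℕ) : Set where
  constructor ⟪_,_,_⟫
  field
    fst : Fin n
    snd : Fin n
    distinct : fst ≢ snd
open Sample public

_∈ₛ_ : ∀ {n} → Fin n → Sample n → Set
c ∈ₛ s = (c ≡ fst s) ⊎ (c ≡ snd s)

-- A (hidden) bijection σ : C → L, with C = L = Fin n (labels named by Fin n).
Bij : ℕ → Set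
Bij n = Fin n ↔ Fin n

Samples : ℕ → Set
Samples n = ℕ → Sample n

InC : ∀ {n} → Samples n → ℕ → Fin n → Set
InC S t c = ∃[ i ] (i < t × c ∈ₛ S i)

PairMatches : ∀ {n} → Bij n → (Fin n → Fin n) → Sample n → Set
PairMatches σ f s =
  (f (fst s) ≡ Inverse.to σ (fst s) × f (snd s) ≡ Inverse.to σ (snd s))
  ⊎ (f (fst s) ≡ Inverse.to σ (snd s) × f (snd s) ≡ Inverse.to σ (fst s))

-- f (only its restriction to C_t matters) is a consistent bijection C_t → L_t:
-- injective on C_t and f(S_i) = σ(S_i) for all i < t.  (Given these,
-- f maps C_t into and onto L_t automatically.)
Consistent : ∀ {n} → Bij n → Samples n → ℕ → (Fin n → Fin n) → Set
Consistent σ S t f =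
  (∀ c d → InC S t c → InC S t d → f c ≡ f d → c ≡ d)
  × (∀ i → i < t → PairMatches σ f (S i))

Determined : ∀ {n} → Bij n → Samples n → ℕ → Fin n → Set
Determined σ S t c =
  InC S t c × (∀ f g → Consistent σ S t f → Consistent σ S t g → f c ≡ g c)

AtLeast : ∀ {n} → ℕ → (Fin n → Set) → Set
AtLeast {n} r P = Σ (Fin r → Fin n) λ v → Injective _≡_ _≡_ v × (∀ k → P (v k))

IsT : ∀ {n} → Bij n → Samples n → ℕ → ℕ → Set
IsT σ S r t =
  AtLeast r (Determined σ S t) × (∀ t′ → t′ < t → ¬ AtLeast r (Determined σ S t′))

-- If coupon c is determined, look at the sample {x, y} that revealed it.
-- Were every sample either {x, y} or disjoint from it, σ composed with the
-- transposition (x y) would be a second consistent bijection disagreeing with σ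
-- at c.  So some sample {u, w} meets {x, y} in exactly one coupon, say u = x.
-- Then x lies in two samples {x, y} and {x, w} with y ≠ w, whose label sets
-- share only σ x; this pins the label of x, and through the two samples those
-- of y and w.  One determined coupon therefore already yields three.
module Submission where

open import Defs
open import Data.Nat using (ℕ; zero; suc; _≤_; _<_; s≤s)
open import Data.Nat.Properties using (≤-refl; m≤n⇒m≤1+n; m≤n⇒m<n∨m≡n)
open import Data.Product using (_×_; _,_; ∃-syntax)
open import Data.Sum using (_⊎_; inj₁; inj₂)
open import Data.Empty using (⊥-elim)
open import Data.Fin using (Fin; inject₁) renaming (zero to 0F; suc to sucF)
open import Data.Fin.Properties using (_≟_; inject₁-injective)
open import Data.Fin.Permutation.Components using (transpose; transpose-inverse)
open import Function using (_∘_; _⇔_; mk⇔; Equivalence; Inverse; Injection)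
open import Function.Definitions using (Injective)
open import Function.Properties.Inverse using (↔⇒↣)
open import Relation.Nullary using (Dec; yes; no)
open import Relation.Nullary.Decidable using (dec-true; dec-false)
open import Relation.Binary.PropositionalEquality
  using (_≡_; _≢_; refl; sym; trans; cong; ≢-sym; module ≡-Reasoning)

module _ {n : ℕ} where

  transpose-matchˡ : (i j : Fin n) → transpose i j i ≡ j
  transpose-matchˡ i j rewrite dec-true (i ≟ i) refl = refl

  transpose-matchʳ : (i j : Fin n) → transpose i j j ≡ i
  transpose-matchʳ i j = by-cases i j (j ≟ i)
    where
    by-cases : ∀ i j → Dec (j ≡ i) → transpose i j j ≡ i
    by-cases i .i (yes refl) = transpose-matchˡ i i
    by-cases i j  (no j≢i) rewrite dec-false (j ≟ i) j≢i | dec-true (j ≟ j) refl = refl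

  transpose-fixes : ∀ {i j k : Fin n} → k ≢ i → k ≢ j → transpose i j k ≡ k
  transpose-fixes {i} {j} {k} k≢i k≢j
    rewrite dec-false (k ≟ i) k≢i | dec-false (k ≟ j) k≢j = refl

  transpose-injective : (i j : Fin n) → Injective _≡_ _≡_ (transpose i j)
  transpose-injective i j {a} {b} eq = begin
    a                                ≡⟨ sym (transpose-inverse j i) ⟩
    transpose j i (transpose i j a)  ≡⟨ cong (transpose j i) eq ⟩
    transpose j i (transpose i j b)  ≡⟨ transpose-inverse j i ⟩
    b                                ∎
    where open ≡-Reasoning

  transpose-moves : ∀ {i j c : Fin n} → i ≢ j → c ≡ i ⊎ c ≡ j → transpose i j c ≢ c
  transpose-moves {i} {j} i≢j (inj₁ refl) eq = i≢j (sym (trans (sym (transpose-matchˡ i j)) eq))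
  transpose-moves {i} {j} i≢j (inj₂ refl) eq = i≢j (trans (sym (transpose-matchʳ i j)) eq)

  Stabilises : (Fin n → Fin n) → Sample n → Set
  Stabilises π e =
    (π (fst e) ≡ fst e × π (snd e) ≡ snd e) ⊎ (π (fst e) ≡ snd e × π (snd e) ≡ fst e)

  Branch : Fin n → Fin n → Sample n → Set
  Branch x y e = ∃[ w ] (x ∈ₛ e × w ∈ₛ e × w ≢ x × w ≢ y)

  transpose-stabilises-or-branches : ∀ {x y} (e : Sample n) → x ≢ y →
    Stabilises (transpose x y) e ⊎ Branch x y e ⊎ Branch y x e
  transpose-stabilises-or-branches {x} {y} ⟪ a , b , a≢b ⟫ x≢y =
    by-cases (a ≟ x) (a ≟ y) (b ≟ x) (b ≟ y)
    where
    τ = transpose x y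
    e = ⟪ a , b , a≢b ⟫
    by-cases : Dec (a ≡ x) → Dec (a ≡ y) → Dec (b ≡ x) → Dec (b ≡ y) →
               Stabilises τ e ⊎ Branch x y e ⊎ Branch y x e
    by-cases (yes refl) _ _ (yes refl) = inj₁ (inj₂ (transpose-matchˡ x y , transpose-matchʳ x y))
    by-cases (yes refl) _ (yes refl) _ = ⊥-elim (a≢b refl)
    by-cases (yes refl) _ (no b≢x) (no b≢y) = inj₂ (inj₁ (b , inj₁ refl , inj₂ refl , b≢x , b≢y))
    by-cases (no _) (yes refl) (yes refl) _ = inj₁ (inj₂ (transpose-matchʳ x y , transpose-matchˡ x y))
    by-cases (no _) (yes refl) _ (yes refl) = ⊥-elim (a≢b refl)
    by-cases (no _) (yes refl) (no b≢x) (no b≢y) = inj₂ (inj₂ (b , inj₁ refl , inj₂ refl , b≢y , b≢x))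
    by-cases (no a≢x) (no a≢y) (yes refl) _ = inj₂ (inj₁ (a , inj₂ refl , inj₁ refl , a≢x , a≢y))
    by-cases (no a≢x) (no a≢y) (no _) (yes refl) = inj₂ (inj₂ (a , inj₂ refl , inj₁ refl , a≢y , a≢x))
    by-cases (no a≢x) (no a≢y) (no b≢x) (no b≢y) =
      inj₁ (inj₁ (transpose-fixes a≢x a≢y , transpose-fixes b≢x b≢y))

  atLeast3 : ∀ {P : Fin n → Set} {a b c} → a ≢ b → a ≢ c → b ≢ c →
             P a → P b → P c → AtLeast 3 P
  atLeast3 {P} {a} {b} {c} a≢b a≢c b≢c pa pb pc = v , v-injective , v-P
    where
    v : Fin 3 → Fin n
    v 0F               = a
    v (sucF 0F)        = b
    v (sucF (sucF 0F)) = c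
    v-injective : Injective _≡_ _≡_ v
    v-injective {0F}               {0F}               _  = refl
    v-injective {0F}               {sucF 0F}          eq = ⊥-elim (a≢b eq)
    v-injective {0F}               {sucF (sucF 0F)}   eq = ⊥-elim (a≢c eq)
    v-injective {sucF 0F}          {0F}               eq = ⊥-elim (a≢b (sym eq))
    v-injective {sucF 0F}          {sucF 0F}          _  = refl
    v-injective {sucF 0F}          {sucF (sucF 0F)}   eq = ⊥-elim (b≢c eq)
    v-injective {sucF (sucF 0F)}   {0F}               eq = ⊥-elim (a≢c (sym eq))
    v-injective {sucF (sucF 0F)}   {sucF 0F}          eq = ⊥-elim (b≢c (sym eq))
    v-injective {sucF (sucF 0F)}   {sucF (sucF 0F)}   _  = refl
    v-P : ∀ k → P (v k)
    v-P 0F               = pa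
    v-P (sucF 0F)        = pb
    v-P (sucF (sucF 0F)) = pc

  AtLeast-suc⇒AtLeast : ∀ {r} {P : Fin n → Set} → AtLeast (suc r) P → AtLeast r P
  AtLeast-suc⇒AtLeast (v , v-injective , v-P) =
    v ∘ inject₁ , inject₁-injective ∘ v-injective , v-P ∘ inject₁

∀<⊎∃< : ∀ {P Q : ℕ → Set} m → (∀ j → j < m → P j ⊎ Q j) →
        (∀ j → j < m → P j) ⊎ ∃[ j ] (j < m × Q j)
∀<⊎∃< zero    _  = inj₁ λ _ ()
∀<⊎∃< {P} (suc m) pq with ∀<⊎∃< m (λ j j<m → pq j (m≤n⇒m≤1+n j<m)) | pq m ≤-refl
... | inj₂ (j , j<m , qj) | _    = inj₂ (j , m≤n⇒m≤1+n j<m , qj)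
... | inj₁ _              | inj₂ qm = inj₂ (m , ≤-refl , qm)
... | inj₁ p<m            | inj₁ pm = inj₁ p≤m
  where
  p≤m : ∀ j → j < suc m → P j
  p≤m j (s≤s j≤m) with m≤n⇒m<n∨m≡n j≤m
  ... | inj₁ j<m  = p<m j j<m
  ... | inj₂ refl = pm

module _ {n : ℕ} (σ : Bij n) where

  private
    σ⁺ : Fin n → Fin n
    σ⁺ = Inverse.to σ

  σ-injective : Injective _≡_ _≡_ σ⁺
  σ-injective = Injection.injective (↔⇒↣ σ)

  stabilises⇒pairMatches : ∀ {π e} → Stabilises π e → PairMatches σ (σ⁺ ∘ π) e
  stabilises⇒pairMatches (inj₁ (πa , πb)) = inj₁ (cong σ⁺ πa , cong σ⁺ πb)
  stabilises⇒pairMatches (inj₂ (πa , πb)) = inj₂ (cong σ⁺ πa , cong σ⁺ πb)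

  pairMatches-members : ∀ {f e x y} → x ∈ₛ e → y ∈ₛ e → (x≢y : x ≢ y) →
                        PairMatches σ f e → PairMatches σ f ⟪ x , y , x≢y ⟫
  pairMatches-members (inj₁ refl) (inj₁ refl) x≢y _ = ⊥-elim (x≢y refl)
  pairMatches-members (inj₂ refl) (inj₂ refl) x≢y _ = ⊥-elim (x≢y refl)
  pairMatches-members (inj₁ refl) (inj₂ refl) _ (inj₁ (fa , fb)) = inj₁ (fa , fb)
  pairMatches-members (inj₁ refl) (inj₂ refl) _ (inj₂ (fa , fb)) = inj₂ (fa , fb)
  pairMatches-members (inj₂ refl) (inj₁ refl) _ (inj₁ (fa , fb)) = inj₁ (fb , fa)
  pairMatches-members (inj₂ refl) (inj₁ refl) _ (inj₂ (fa , fb)) = inj₂ (fb , fa)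

  module _ (S : Samples n) (t : ℕ) where

    Adjacent : Fin n → Fin n → Set
    Adjacent x y = ∃[ i ] (i < t × x ∈ₛ S i × y ∈ₛ S i)

    adjacent-sym : ∀ {x y} → Adjacent x y → Adjacent y x
    adjacent-sym (i , i<t , x∈ , y∈) = i , i<t , y∈ , x∈

    adjacent⇒InC : ∀ {x y} → Adjacent x y → InC S t x
    adjacent⇒InC (i , i<t , x∈ , _) = i , i<t , x∈

    adjacent-matches : ∀ {f x y} → Consistent σ S t f → (x≢y : x ≢ y) → Adjacent x y →
                       PairMatches σ f ⟪ x , y , x≢y ⟫
    adjacent-matches {f} (_ , matches) x≢y (i , i<t , x∈ , y∈) =
      pairMatches-members {f} {S i} x∈ y∈ x≢y (matches i i<t)

    Pinned : Fin n → Set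
    Pinned x = InC S t x × (∀ f → Consistent σ S t f → f x ≡ σ⁺ x)

    pinned⇒determined : ∀ {x} → Pinned x → Determined σ S t x
    pinned⇒determined (x∈ , pinned) = x∈ , λ f g f-cons g-cons →
      trans (pinned f f-cons) (sym (pinned g g-cons))

    hub-pinned : ∀ {x y z} → x ≢ y → x ≢ z → y ≢ z →
                 Adjacent x y → Adjacent x z → Pinned x
    hub-pinned {x} {y} {z} x≢y x≢z y≢z xy xz = adjacent⇒InC xy , pinned
      where
      pinned : ∀ f → Consistent σ S t f → f x ≡ σ⁺ x
      pinned f f-cons with adjacent-matches f-cons x≢y xy | adjacent-matches f-cons x≢z xz
      ... | inj₁ (fx , _) | _              = fx
      ... | inj₂ _        | inj₁ (fx , _)  = fx
      ... | inj₂ (fx≡σy , _) | inj₂ (fx≡σz , _) = ⊥-elim (y≢z (σ-injective (trans (sym fx≡σy) fx≡σz)))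

    pinned-spreads : ∀ {x y} → Pinned x → x ≢ y → Adjacent x y → Pinned y
    pinned-spreads {x} {y} (_ , x-pinned) x≢y xy = adjacent⇒InC (adjacent-sym xy) , pinned
      where
      pinned : ∀ f → Consistent σ S t f → f y ≡ σ⁺ y
      pinned f f-cons with adjacent-matches f-cons x≢y xy
      ... | inj₁ (_ , fy)    = fy
      ... | inj₂ (fx≡σy , _) = ⊥-elim (x≢y (σ-injective (trans (sym (x-pinned f f-cons)) fx≡σy)))

    branch⇒AtLeast3 : ∀ {x y} → x ≢ y → Adjacent x y →
                      ∃[ j ] (j < t × Branch x y (S j)) → AtLeast 3 (Determined σ S t)
    branch⇒AtLeast3 {x} x≢y xy (j , j<t , w , x∈ , w∈ , w≢x , w≢y) =
      atLeast3 x≢y (≢-sym w≢x) (≢-sym w≢y)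
        (pinned⇒determined x-pinned)
        (pinned⇒determined (pinned-spreads x-pinned x≢y xy))
        (pinned⇒determined (pinned-spreads x-pinned (≢-sym w≢x) xw))
      where
      xw : Adjacent x w
      xw = j , j<t , x∈ , w∈
      x-pinned : Pinned x
      x-pinned = hub-pinned x≢y (≢-sym w≢x) (≢-sym w≢y) xy xw

    σ-consistent : Consistent σ S t σ⁺
    σ-consistent = (λ _ _ _ _ → σ-injective) , (λ _ _ → inj₁ (refl , refl))

    transposed-consistent : ∀ {x y} → (∀ j → j < t → Stabilises (transpose x y) (S j)) →
                            Consistent σ S t (σ⁺ ∘ transpose x y)
    transposed-consistent {x} {y} stable =
      (λ _ _ _ _ → transpose-injective x y ∘ σ-injective) ,
      (λ j j<t → stabilises⇒pairMatches {transpose x y} {S j} (stable j j<t))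

    determined-edge⇒AtLeast3 : ∀ {c x y} → x ≢ y → Adjacent x y → c ≡ x ⊎ c ≡ y →
                               Determined σ S t c → AtLeast 3 (Determined σ S t)
    determined-edge⇒AtLeast3 {c} {x} {y} x≢y xy c∈ (_ , determined)
      with ∀<⊎∃< t (λ j _ → transpose-stabilises-or-branches (S j) x≢y)
    ... | inj₂ (j , j<t , inj₁ branch) = branch⇒AtLeast3 x≢y xy (j , j<t , branch)
    ... | inj₂ (j , j<t , inj₂ branch) =
      branch⇒AtLeast3 (≢-sym x≢y) (adjacent-sym xy) (j , j<t , branch)
    ... | inj₁ stable = ⊥-elim (transpose-moves x≢y c∈ (sym (σ-injective σc≡στc)))
      where
      σc≡στc : σ⁺ c ≡ σ⁺ (transpose x y c)
      σc≡στc = determined σ⁺ (σ⁺ ∘ transpose x y) σ-consistent (transposed-consistent stable)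

    determined⇒AtLeast3 : ∀ {c} → Determined σ S t c → AtLeast 3 (Determined σ S t)
    determined⇒AtLeast3 c-det@((i , i<t , c∈) , _) =
      determined-edge⇒AtLeast3 (distinct (S i)) (i , i<t , inj₁ refl , inj₂ refl) c∈ c-det

IsT-cong : ∀ {n} (σ : Bij n) (S : Samples n) {r r′} →
           (∀ t → AtLeast r (Determined σ S t) ⇔ AtLeast r′ (Determined σ S t)) →
           ∀ t → IsT σ S r t ⇔ IsT σ S r′ t
IsT-cong σ S r⇔r′ t = mk⇔
  (λ (reached , minimal) → to (r⇔r′ t) reached , λ t′ t′<t → minimal t′ t′<t ∘ from (r⇔r′ t′))
  (λ (reached , minimal) → from (r⇔r′ t) reached , λ t′ t′<t → minimal t′ t′<t ∘ to (r⇔r′ t′))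
  where open Equivalence

claim1 : (n : ℕ) → 3 ≤ n → (σ : Bij n) → (S : Samples n) → (t : ℕ) →
    (IsT σ S 1 t ⇔ IsT σ S 2 t) × (IsT σ S 2 t ⇔ IsT σ S 3 t)
claim1 n _ σ S t = IsT-cong σ S one⇔two t , IsT-cong σ S two⇔three t
  where
  shrink : ∀ {r} t → AtLeast (suc r) (Determined σ S t) → AtLeast r (Determined σ S t)
  shrink t = AtLeast-suc⇒AtLeast {P = Determined σ S t}
  one⇒three : ∀ t → AtLeast 1 (Determined σ S t) → AtLeast 3 (Determined σ S t)
  one⇒three t (v , _ , v-determined) = determined⇒AtLeast3 σ S t (v-determined 0F)
  one⇔two : ∀ t → AtLeast 1 (Determined σ S t) ⇔ AtLeast 2 (Determined σ S t)
  one⇔two t = mk⇔ (shrink t ∘ one⇒three t) (shrink t)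
  two⇔three : ∀ t → AtLeast 2 (Determined σ S t) ⇔ AtLeast 3 (Determined σ S t)
  two⇔three t = mk⇔ (one⇒three t ∘ shrink t) (shrink t)
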